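{- Let $k\in\mathbb{N}$, let $u$ be an infinite word over $\Sigma$, and let $\tau$ be the stationary type of $u$, i.e. a $\mathrm{prefFO}$ $k$-type such that there exists $n\in\mathbb{N}$ with $u[0\dots m]$ having $\mathrm{prefFO}$ $k$-type $\tau$ for every $m\geq n$. Then the $\mathrm{prefFO}$ $k$-type of $u$ is $\tau$.
   Context: $\Sigma$ is a finite alphabet; $u[0\dots m]$ denotes the prefix of $u$ consisting of positions $0$ to $m$. Prefix first-order logic on words ($\mathrm{prefFO}$): first-order logic over (finite or infinite) words on $\Sigma$ with the order $<$ on positions and a unary predicate for each letter, restricted to sentences which start with a quantification (existential or universal) of a variable $\bar x$, after which every further quantification is of the form $\exists x<\bar x$ or $\forall x<\bar x$ (together with Boolean combinations of such sentences). The $\mathrm{prefFO}$ $k$-type of a word $w$ is the set of all $\mathrm{prefFO}$ sentences of quantifier depth at most $k$ satisfied by $w$. -}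

module Defs where

open import Data.Nat using (ℕ; zero; suc; _≤_; _<_; _⊔_)
open import Data.Fin using (Fin)
open import Data.Unit using (⊤)
open import Data.Empty using (⊥)
open import Data.Product using (Σ; _×_; ∃)
open import Data.Sum using (_⊎_)
open import Relation.Binary.PropositionalEquality using (_≡_)
open import Relation.Nullary using (¬_)
open import Function.Bundles using (_⇔_)

-- Words (finite or infinite): a set of positions (a downward closed
-- subset of ℕ in all uses below) together with a labelling of positions.
record Word (s : ℕ) : Set₁ where
  field
    dom    : ℕ → Set
    letter : ℕ → Fin s

infWord : ∀ {s} → (ℕ → Fin s) → Word s
infWord u = record { dom = λ _ → ⊤ ; letter = u }

prefix : ∀ {s} → (ℕ → Fin s) → ℕ → Word s
prefix u m = record { dom = λ x → x ≤ m ; letter = u }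

-- Terms inside the scope of the outer quantifier: either the distinguished
-- variable x̄ or one of the n variables bound by guarded quantifiers.
data Term (n : ℕ) : Set where
  bar : Term n
  var : Fin n → Term n

-- Formulas occurring below the leading quantification of x̄:
-- every quantification is ∃ x < x̄ or ∀ x < x̄.
data Inner (s : ℕ) : ℕ → Set where
  lett   : ∀ {n} → Fin s → Term n → Inner s n
  less   : ∀ {n} → Term n → Term n → Inner s n
  equal  : ∀ {n} → Term n → Term n → Inner s n
  neg    : ∀ {n} → Inner s n → Inner s n
  and    : ∀ {n} → Inner s n → Inner s n → Inner s n
  or     : ∀ {n} → Inner s n → Inner s n → Inner s n
  exLt   : ∀ {n} → Inner s (suc n) → Inner s n
  allLt  : ∀ {n} → Inner s (suc n) → Inner s n

data Sentence (s : ℕ) : Set where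
  exBar  : Inner s 0 → Sentence s
  allBar : Inner s 0 → Sentence s
  sneg   : Sentence s → Sentence s
  sand   : Sentence s → Sentence s → Sentence s
  sor    : Sentence s → Sentence s → Sentence s

depthI : ∀ {s n} → Inner s n → ℕ
depthI (lett _ _)   = 0
depthI (less _ _)   = 0
depthI (equal _ _)  = 0
depthI (neg φ)      = depthI φ
depthI (and φ ψ)    = depthI φ ⊔ depthI ψ
depthI (or φ ψ)     = depthI φ ⊔ depthI ψ
depthI (exLt φ)     = suc (depthI φ)
depthI (allLt φ)    = suc (depthI φ)

depth : ∀ {s} → Sentence s → ℕ
depth (exBar φ)  = suc (depthI φ)
depth (allBar φ) = suc (depthI φ)
depth (sneg φ)   = depth φ
depth (sand φ ψ) = depth φ ⊔ depth ψ
depth (sor φ ψ)  = depth φ ⊔ depth ψ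

ext : ∀ {n} → (Fin n → ℕ) → ℕ → Fin (suc n) → ℕ
ext ρ x Fin.zero    = x
ext ρ x (Fin.suc i) = ρ i

val : ∀ {n} → ℕ → (Fin n → ℕ) → Term n → ℕ
val x̄ ρ bar     = x̄
val x̄ ρ (var i) = ρ i

-- All positions considered in inner formulas are ≤ x̄, hence lie in the
-- word's domain, so only the letter labelling is needed.
SatI : ∀ {s n} → (ℕ → Fin s) → (x̄ : ℕ) → (Fin n → ℕ) → Inner s n → Set
SatI w x̄ ρ (lett a t)  = w (val x̄ ρ t) ≡ a
SatI w x̄ ρ (less t t') = val x̄ ρ t < val x̄ ρ t'
SatI w x̄ ρ (equal t t') = val x̄ ρ t ≡ val x̄ ρ t'
SatI w x̄ ρ (neg φ)     = ¬ SatI w x̄ ρ φ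
SatI w x̄ ρ (and φ ψ)   = SatI w x̄ ρ φ × SatI w x̄ ρ ψ
SatI w x̄ ρ (or φ ψ)    = SatI w x̄ ρ φ ⊎ SatI w x̄ ρ ψ
SatI w x̄ ρ (exLt φ)    = ∃ λ x → x < x̄ × SatI w x̄ (ext ρ x) φ
SatI w x̄ ρ (allLt φ)   = ∀ x → x < x̄ → SatI w x̄ (ext ρ x) φ

noVars : Fin 0 → ℕ
noVars ()

Sat : ∀ {s} → Word s → Sentence s → Set
Sat w (exBar φ)  = ∃ λ x̄ → Word.dom w x̄ × SatI (Word.letter w) x̄ noVars φ
Sat w (allBar φ) = ∀ x̄ → Word.dom w x̄ → SatI (Word.letter w) x̄ noVars φ
Sat w (sneg φ)   = ¬ Sat w φ
Sat w (sand φ ψ) = Sat w φ × Sat w ψ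
Sat w (sor φ ψ)  = Sat w φ ⊎ Sat w ψ

PrefType : ℕ → Set₁
PrefType s = Sentence s → Set

HasType : ∀ {s} → ℕ → Word s → PrefType s → Set
HasType k w τ = ∀ φ → τ φ ⇔ (depth φ ≤ k × Sat w φ)

-- For any bound n, ∃x̄ φ holds in u iff it holds in some prefix u[0…m] with
-- m ≥ n, and ∀x̄ φ iff it holds in every such prefix, because the guarded
-- quantifiers only inspect positions below x̄. When all prefixes beyond n
-- agree with u[0…n] on depth-k sentences, these leading quantifications, and
-- hence all their Boolean combinations, have the same truth value in u as in
-- u[0…n]; so u has the k-type τ of u[0…n].
module Submission where

open import Defs
open import Data.Nat using (ℕ; _≤_; _⊔_)
open import Data.Nat.Properties using (≤-refl; m≤m⊔n; m≤n⊔m; m⊔n≤o⇒m≤o; m⊔n≤o⇒n≤o)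
open import Data.Fin using (Fin)
open import Data.Product using (∃; _,_; _×_)
open import Data.Product.Function.NonDependent.Propositional using (_×-⇔_)
open import Data.Sum.Function.Propositional using (_⊎-⇔_)
open import Function.Bundles using (_⇔_; mk⇔; module Equivalence)
open import Function.Related.TypeIsomorphisms using (¬-cong-⇔)

open Equivalence using (to; from)

infix 4 _≈[_]_

_≈[_]_ : ∀ {s} → Word s → ℕ → Word s → Set
w ≈[ k ] w′ = ∀ φ → depth φ ≤ k → Sat w φ ⇔ Sat w′ φ

module _ {s k : ℕ} {w w′ : Word s} where

  HasType⇒≈ : ∀ {τ} → HasType k w τ → HasType k w′ τ → w ≈[ k ] w′
  HasType⇒≈ hw hw′ φ d = mk⇔
    (λ p → let (_ , p′) = to (hw′ φ) (from (hw φ) (d , p)) in p′)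
    (λ p′ → let (_ , p) = to (hw φ) (from (hw′ φ) (d , p′)) in p)

  HasType-resp-≈ : ∀ {τ} → w′ ≈[ k ] w → HasType k w τ → HasType k w′ τ
  HasType-resp-≈ w′≈w hw φ = mk⇔
    (λ t → let (d , p) = to (hw φ) t in d , from (w′≈w φ d) p)
    (λ (d , p′) → from (hw φ) (d , to (w′≈w φ d) p′))

  ≈-fromLeading :
    (∀ φ → depth (exBar φ) ≤ k → Sat w (exBar φ) ⇔ Sat w′ (exBar φ)) →
    (∀ φ → depth (allBar φ) ≤ k → Sat w (allBar φ) ⇔ Sat w′ (allBar φ)) →
    w ≈[ k ] w′
  ≈-fromLeading ex all = agree
    where
    agree : w ≈[ k ] w′
    agree (exBar φ)  d = ex φ d
    agree (allBar φ) d = all φ d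
    agree (sneg φ)   d = ¬-cong-⇔ (agree φ d)
    agree (sand φ ψ) d = agree φ (m⊔n≤o⇒m≤o _ _ d) ×-⇔ agree ψ (m⊔n≤o⇒n≤o _ _ d)
    agree (sor φ ψ)  d = agree φ (m⊔n≤o⇒m≤o _ _ d) ⊎-⇔ agree ψ (m⊔n≤o⇒n≤o _ _ d)

module _ {s : ℕ} (u : ℕ → Fin s) (φ : Inner s 0) (n : ℕ) where

  infWord-exBar⇔prefix : Sat (infWord u) (exBar φ) ⇔ (∃ λ m → n ≤ m × Sat (prefix u m) (exBar φ))
  infWord-exBar⇔prefix = mk⇔
    (λ (x̄ , _ , p) → n ⊔ x̄ , m≤m⊔n n x̄ , x̄ , m≤n⊔m n x̄ , p)
    (λ (_ , _ , x̄ , _ , p) → x̄ , _ , p)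

  infWord-allBar⇔prefix : Sat (infWord u) (allBar φ) ⇔ (∀ m → n ≤ m → Sat (prefix u m) (allBar φ))
  infWord-allBar⇔prefix = mk⇔
    (λ f _ _ x̄ _ → f x̄ _)
    (λ g x̄ _ → g (n ⊔ x̄) (m≤m⊔n n x̄) x̄ (m≤n⊔m n x̄))

infWord-≈-stablePrefix : ∀ {s} k (u : ℕ → Fin s) n →
                         (∀ m → n ≤ m → prefix u m ≈[ k ] prefix u n) →
                         infWord u ≈[ k ] prefix u n
infWord-≈-stablePrefix k u n stable = ≈-fromLeading
  (λ φ d → let ex = infWord-exBar⇔prefix u φ n in mk⇔
    (λ p → let (m , n≤m , pₘ) = to ex p in to (stable m n≤m (exBar φ) d) pₘ)
    (λ pₙ → from ex (n , ≤-refl , pₙ)))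
  (λ φ d → let all = infWord-allBar⇔prefix u φ n in mk⇔
    (λ p → to all p n ≤-refl)
    (λ pₙ → from all (λ m n≤m → from (stable m n≤m (allBar φ) d) pₙ)))

lemma3 : ∀ {s : ℕ} (k : ℕ) (u : ℕ → Fin s) (τ : PrefType s)
         → (∃ λ n → ∀ m → n ≤ m → HasType k (prefix u m) τ)
         → HasType k (infWord u) τ
lemma3 k u τ (n , typed) = HasType-resp-≈ u≈uₙ (typed n ≤-refl)
  where
  u≈uₙ : infWord u ≈[ k ] prefix u n
  u≈uₙ = infWord-≈-stablePrefix k u n (λ m n≤m → HasType⇒≈ (typed m n≤m) (typed n ≤-refl))
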